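{- For any treelike snark $G(T,C)$, we have $\chi'_N(G(T,C))\leq 6$.
   Context: A Halin graph is a plane graph obtained from a planar embedding of a tree $T$ with no degree-two vertices by joining its leaves by a cycle $C$ through the leaves in their clockwise order $l_1,\dots,l_n$. Let $K$ be a cubic Halin graph with $|V(K)|\geq 4$, with tree $T$ and cycle $C$. Let $P_0$ be the following 5-zone: it has vertices $x_1,\dots,x_8,y_1,y_2,y_3$ and edges $x_1x_2, x_1x_4, x_2x_3, x_2x_7, x_3x_5, x_4x_5, x_4x_6, x_5x_8, x_6x_7, x_7x_8, x_1y_1, y_1y_2, y_2y_3, x_8y_3$, together with five dangling semi-edges $b_1$ at $y_3$, $b_2$ at $y_1$, $b_3$ at $y_2$, $b_4$ at $x_3$, $b_5$ at $x_6$ (so $x_1,\dots,x_8$ induce the Petersen graph minus two adjacent vertices, and every vertex has degree $3$ counting semi-edges). The treelike snark $G(T,C)$ is obtained as follows: take $n$ copies $P_0^1,\dots,P_0^n$ of $P_0$; for each $i$, identify the vertex $y_2^i$ (the end of $b_3^i$) with the leaf $l_i$ of $T$, so that the edge of $T$ at $l_i$ plays the role of $b_3^i$; the edges of $C$ are not used; then for each $i$ (indices modulo $n$) join $b_4^i$ with $b_2^{i+1}$ into an edge and $b_5^i$ with $b_1^{i+1}$ into an edge. A $k$-edge-coloring is a proper edge-coloring with colors from $\{1,\dots,k\}$. For an edge-coloring $c$ and a vertex $v$, let $S_c(v)$ be the set of colors on edges incident with $v$. An edge $uv$ of a cubic graph is poor if $|S_c(u)\cup S_c(v)|=3$, rich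 if $|S_c(u)\cup S_c(v)|=5$, and normal if it is poor or rich. An edge-coloring is normal if every edge is normal. $\chi'_N(G)$ is the smallest $k$ such that $G$ admits a normal $k$-edge-coloring. -}

module Defs where

open import Data.Nat using (ℕ; zero; suc; _+_; _*_; _≤_; _≡ᵇ_)
open import Data.Nat.DivMod using (_%_)
open import Data.Bool using (Bool; if_then_else_; _∨_)
open import Data.Fin using (Fin)
open import Data.Fin.Subset using (Subset; ⁅_⁆; _∪_; ∣_∣) renaming (⊥ to ∅)
open import Data.List using (List; []; _∷_; _++_; length; lookup; allFin; upTo; foldr; concatMap)
open import Data.Product using (_×_; _,_; proj₁; proj₂; Σ; ∃)
open import Data.Sum using (_⊎_)
open import Relation.Binary.PropositionalEquality using (_≡_; _≢_)

Edge : Set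
Edge = ℕ × ℕ

Graph : Set
Graph = List Edge

incident : ℕ → Edge → Bool
incident v (a , b) = (v ≡ᵇ a) ∨ (v ≡ᵇ b)

SharesEnd : Edge → Edge → Set
SharesEnd (a , b) (a' , b') = (a ≡ a') ⊎ (a ≡ b') ⊎ (b ≡ a') ⊎ (b ≡ b')

-- an edge-colouring with colours {1..k} (represented by Fin k)
EdgeColoring : ℕ → Graph → Set
EdgeColoring k G = Fin (length G) → Fin k

Proper : ∀ {k} (G : Graph) → EdgeColoring k G → Set
Proper G c = ∀ e f → e ≢ f → SharesEnd (lookup G e) (lookup G f) → c e ≢ c f

S : ∀ {k} (G : Graph) → EdgeColoring k G → ℕ → Subset k
S G c v = foldr (λ f acc → if incident v (lookup G f) then ⁅ c f ⁆ ∪ acc else acc)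
                ∅ (allFin (length G))

NormalEdge : ∀ {k} (G : Graph) → EdgeColoring k G → Edge → Set
NormalEdge G c (u , v) = (∣ S G c u ∪ S G c v ∣ ≡ 3) ⊎ (∣ S G c u ∪ S G c v ∣ ≡ 5)

NormalColoring : ∀ k (G : Graph) → EdgeColoring k G → Set
NormalColoring k G c = Proper G c × (∀ e → NormalEdge G c (lookup G e))

χN≤ : Graph → ℕ → Set
χN≤ G m = Σ ℕ λ k → k ≤ m × Σ (EdgeColoring k G) λ c → NormalColoring k G c

-- A plane tree whose internal vertices all have
-- degree 3, with at least 4 vertices, rooted at a leaf l₁, is exactly a
-- leaf l₁ attached to the root of an ordered (plane) full binary tree
-- `nd a b`.  The leaves in (clockwise) order are l₁ followed by the
-- leaves of `nd a b` from left to right.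

data BTree : Set where
  lf : BTree
  nd : BTree → BTree → BTree

nLeaves : BTree → ℕ
nLeaves lf = 1
nLeaves (nd a b) = nLeaves a + nLeaves b

-- Copy i (0 ≤ i < n) of P₀ uses vertices 11*i + j:
--   x₁..x₈ ↦ j = 0..7,  y₁ ↦ 8,  y₂ ↦ 9 (= leaf lᵢ₊₁),  y₃ ↦ 10.
-- Internal vertices of T get the numbers base + 0, base + 1, … with base = 11*n.

vx : ℕ → ℕ → ℕ
vx i j = 11 * i + j

vy1 vy2 vy3 : ℕ → ℕ
vy1 i = 11 * i + 8
vy2 i = 11 * i + 9
vy3 i = 11 * i + 10

-- the edges of one copy of P₀ (semi-edges excluded)
P0edges : ℕ → Graph
P0edges i =
    (vx i 0 , vx i 1) ∷ (vx i 0 , vx i 3) ∷ (vx i 1 , vx i 2) ∷ (vx i 1 , vx i 6)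
  ∷ (vx i 2 , vx i 4) ∷ (vx i 3 , vx i 4) ∷ (vx i 3 , vx i 5) ∷ (vx i 4 , vx i 7)
  ∷ (vx i 5 , vx i 6) ∷ (vx i 6 , vx i 7)
  ∷ (vx i 0 , vy1 i) ∷ (vy1 i , vy2 i) ∷ (vy2 i , vy3 i) ∷ (vx i 7 , vy3 i) ∷ []

-- edges of the tree part below a subtree; arguments: base, subtree,
-- parent vertex, next leaf index, next internal-node index.
-- Returns edges, next leaf index, next internal-node index.
treeEdges : ℕ → BTree → ℕ → ℕ → ℕ → Graph × ℕ × ℕ
treeEdges base lf p li ni = ((p , vy2 li) ∷ []) , suc li , ni
treeEdges base (nd a b) p li ni =
  let v  = base + ni
      ra = treeEdges base a v li (suc ni)
      rb = treeEdges base b v (proj₁ (proj₂ ra)) (proj₂ (proj₂ ra))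
  in ((p , v) ∷ proj₁ ra ++ proj₁ rb) , proj₁ (proj₂ rb) , proj₂ (proj₂ rb)

-- The treelike snark G(T,C) for T = leaf l₁ joined to the root of `nd a b`.
-- n = number of leaves = suc (nLeaves a + nLeaves b).
treelikeSnark : BTree → BTree → Graph
treelikeSnark a b =
  proj₁ (treeEdges base (nd a b) (vy2 0) 1 0)
  ++ concatMap P0edges (upTo n)
  ++ concatMap (λ i → (vx i 2 , vy1 ((suc i) % n)) ∷ (vx i 5 , vy3 ((suc i) % n)) ∷ [])
               (upTo n)
  where
    m = nLeaves a + nLeaves b
    n = suc m
    base = 11 * n

module Submission where

-- Colour the cubic tree properly with colours 0, 1, 2 by passing the colour of the edge into an inner
-- vertex on to its two child edges after one and two rotations of {0, 1, 2}.  Give every connector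
-- b₄b₂ colour 0 and every connector b₅b₁ colour 1, and colour copy i of P₀ by one of three fixed
-- patterns, chosen by the colour χ of its tree edge at y₂.  Then the colours around an inner tree
-- vertex are {0, 1, 2}, and the colours around a vertex of a copy depend only on its position in
-- the copy and on χ.  Normality of every edge thus reduces to finitely many local configurations,
-- which are checked by evaluation.

open import Defs

open import Data.Bool using (true; false; if_then_else_; T)
open import Data.Bool.Properties using (T-∨)
open import Data.Empty using (⊥; ⊥-elim)
open import Data.Fin using (Fin; zero; suc; _↑ˡ_; #_)
open import Data.Fin.Properties using () renaming (_≟_ to _≟ᶠ_)
import Data.Fin.Properties as Finₚ
open import Data.Fin.Subset using (Subset; ⁅_⁆; _∪_; ∣_∣) renaming (⊥ to ∅)
open import Data.List using (List; []; _∷_; [_]; _++_; lookup; map; foldr; tabulate; allFin; concatMap; upTo; zip)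
open import Data.List.Properties
  using (map-++; map-concatMap; concatMap-cong; foldr-map; map-tabulate; concatMap-++; upTo-∷ʳ; ++-identityʳ)
open import Data.List.Membership.Propositional using (_∈_)
open import Data.List.Membership.Propositional.Properties using (∈-lookup)
open import Data.List.Relation.Unary.All as All using (All; []; _∷_)
import Data.List.Relation.Unary.All.Properties as Allₚ
open import Data.List.Relation.Unary.AllPairs using (_∷_)
open import Data.List.Relation.Unary.Any using (here; there)
import Data.List.Relation.Unary.Unique.DecPropositional as UniqueDec
open import Data.Nat using (ℕ; zero; suc; _+_; _*_; _≤_; _<_; _≡ᵇ_; _<?_; z≤n; z<s; s≤s; NonZero)
open import Data.Nat.DivMod using (_%_; m<n⇒m%n≡m; %-remove-+ˡ; n%n≡0; m%n<n)
open import Data.Nat.Divisibility using (m∣m*n)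
open import Data.Nat.Properties
  using ( ≡ᵇ⇒≡; ≡⇒≡ᵇ; module ≤-Reasoning; 1+n≢0; n<1+n; suc-injective
        ; ≤-refl; ≤-trans; <-trans; <-≤-trans; <⇒≤; <⇒≱; <⇒≢; ≮⇒≥; m≤n⇒m<n∨m≡n; m<n⇒m<1+n; m<1+n⇒m<n∨m≡n
        ; m≤m+n; m<m+n; +-monoʳ-≤; +-monoʳ-<; *-monoʳ-≤; +-assoc; +-suc; +-identityʳ; +-comm; *-suc
        ; +-cancelˡ-≡; +-cancelʳ-≡; *-cancelˡ-≡ )
  renaming (_≟_ to _≟ⁿ_)
open import Data.Product using (_×_; _,_; proj₁; proj₂; map₂; ∃-syntax)
open import Data.Sum as Sum using (_⊎_; inj₁; inj₂)
open import Relation.Nullary using (Dec; yes; no; ¬_; contradiction)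
open import Relation.Nullary.Decidable using (True; toWitness; _×-dec_; _⊎-dec_)
open import Relation.Binary.PropositionalEquality hiding ([_])
open import Function using (_∘_; Equivalence)

-- Index arithmetic and vertex numbering

+-cancelˡ-≡ᵇ : ∀ x m n → (x + m ≡ᵇ x + n) ≡ (m ≡ᵇ n)
+-cancelˡ-≡ᵇ zero    m n = refl
+-cancelˡ-≡ᵇ (suc x) m n = +-cancelˡ-≡ᵇ x m n

*+-injective : ∀ d .{{_ : NonZero d}} {q q′ r r′} → r < d → r′ < d → d * q + r ≡ d * q′ + r′ → q ≡ q′ × r ≡ r′
*+-injective d {q} {q′} {r} {r′} r<d r′<d eq = q≡q′ , r≡r′
  where
  open ≡-Reasoning
  r≡r′ : r ≡ r′
  r≡r′ = begin
    r                  ≡⟨ m<n⇒m%n≡m r<d ⟨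
    r % d              ≡⟨ %-remove-+ˡ r (m∣m*n q) ⟨
    (d * q + r) % d    ≡⟨ cong (_% d) eq ⟩
    (d * q′ + r′) % d  ≡⟨ %-remove-+ˡ r′ (m∣m*n q′) ⟩
    r′ % d             ≡⟨ m<n⇒m%n≡m r′<d ⟩
    r′                 ∎
  q≡q′ : q ≡ q′
  q≡q′ = *-cancelˡ-≡ q q′ d (+-cancelʳ-≡ r′ (d * q) (d * q′) (subst (λ x → d * q + x ≡ d * q′ + r′) r≡r′ eq))

suc%-preimage : ∀ m {l} → l < suc m →
                ∃[ i ] i < suc m × suc i % suc m ≡ l × (∀ {i′} → i′ < suc m → suc i′ % suc m ≡ l → i′ ≡ i)
suc%-preimage m {zero} _ = m , ≤-refl , n%n≡0 (suc m) , unique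
  where
  unique : ∀ {i′} → i′ < suc m → suc i′ % suc m ≡ 0 → i′ ≡ m
  unique i′<1+m eq with m<1+n⇒m<n∨m≡n i′<1+m
  ... | inj₁ i′<m  = contradiction (trans (sym (m<n⇒m%n≡m (s≤s i′<m))) eq) λ ()
  ... | inj₂ i′≡m = i′≡m
suc%-preimage m {suc l} l+1<1+m = l , <-trans (n<1+n l) l+1<1+m , m<n⇒m%n≡m l+1<1+m , unique
  where
  unique : ∀ {i′} → i′ < suc m → suc i′ % suc m ≡ suc l → i′ ≡ l
  unique i′<1+m eq with m<1+n⇒m<n∨m≡n i′<1+m
  ... | inj₁ i′<m  = suc-injective (trans (sym (m<n⇒m%n≡m (s≤s i′<m))) eq)
  ... | inj₂ refl = contradiction (trans (sym (n%n≡0 (suc m))) eq) λ ()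

InRange : ℕ → ℕ → ℕ → Set
InRange lo len k = lo ≤ k × k < lo + len

inRange-+ˡ : ∀ {lo x y k} → InRange lo x k → InRange lo (x + y) k
inRange-+ˡ {lo} {x} {y} (lo≤k , k<) = lo≤k , <-≤-trans k< (+-monoʳ-≤ lo (m≤m+n x y))

inRange-+ʳ : ∀ {lo x y k} → InRange (lo + x) y k → InRange lo (x + y) k
inRange-+ʳ {lo} {x} {y} {k} (lo+x≤k , k<) = ≤-trans (m≤m+n lo x) lo+x≤k , subst (k <_) (+-assoc lo x y) k<

inRange-split : ∀ {lo x y k} → InRange lo (x + y) k → InRange lo x k ⊎ InRange (lo + x) y k
inRange-split {lo} {x} {y} {k} (lo≤k , k<) with k <? lo + x
... | yes k<lo+x = inj₁ (lo≤k , k<lo+x)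
... | no  k≮lo+x = inj₂ (≮⇒≥ k≮lo+x , subst (k <_) (sym (+-assoc lo x y)) k<)

inRange-disjoint : ∀ {lo x y k} → InRange lo x k → InRange (lo + x) y k → ⊥
inRange-disjoint (_ , k<lo+x) (lo+x≤k , _) = <⇒≱ k<lo+x lo+x≤k

inRange-lo : ∀ lo x → InRange lo (suc x) lo
inRange-lo lo x = ≤-refl , m<m+n lo z<s

inRange-suc⁺ : ∀ {lo x k} → InRange (suc lo) x k → InRange lo (suc x) k
inRange-suc⁺ {lo} {x} {k} (lo<k , k<) = <⇒≤ lo<k , subst (k <_) (sym (+-suc lo x)) k<

inRange-suc⁻ : ∀ {lo x k} → InRange lo (suc x) k → k ≡ lo ⊎ InRange (suc lo) x k
inRange-suc⁻ {lo} {x} {k} (lo≤k , k<) with m≤n⇒m<n∨m≡n lo≤k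
... | inj₁ lo<k  = inj₂ (lo<k , subst (k <_) (+-suc lo x) k<)
... | inj₂ lo≡k = inj₁ (sym lo≡k)

inRange-empty : ∀ {lo k} → ¬ InRange lo 0 k
inRange-empty {lo} {k} (lo≤k , k<) = <⇒≱ (subst (k <_) (+-identityʳ lo) k<) lo≤k

inRange-single : ∀ {lo k} → InRange lo 1 k → k ≡ lo
inRange-single r with inRange-suc⁻ r
... | inj₁ k≡lo = k≡lo
... | inj₂ r′   = ⊥-elim (inRange-empty r′)

inRange-below : ∀ {lo len k} → k < lo → ¬ InRange lo len k
inRange-below k<lo (lo≤k , _) = <⇒≱ k<lo lo≤k

concatMap-upTo-suc : ∀ {A : Set} (f : ℕ → List A) n → concatMap f (upTo (suc n)) ≡ concatMap f (upTo n) ++ f n ++ []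
concatMap-upTo-suc f n = trans (cong (concatMap f) (sym (upTo-∷ʳ n))) (concatMap-++ f (upTo n) [ n ])

concatMap-upTo-[] : ∀ {A : Set} (f : ℕ → List A) n → (∀ {i} → i < n → f i ≡ []) →
                    concatMap f (upTo n) ≡ []
concatMap-upTo-[] f zero    empty = refl
concatMap-upTo-[] f (suc n) empty = begin
  concatMap f (upTo (suc n))                ≡⟨ concatMap-upTo-suc f n ⟩
  concatMap f (upTo n) ++ f n ++ []         ≡⟨ cong₂ (λ xs ys → xs ++ ys ++ [])
                                                     (concatMap-upTo-[] f n (empty ∘ m<n⇒m<1+n)) (empty ≤-refl) ⟩
  []                                        ∎
  where open ≡-Reasoning

concatMap-upTo-single : ∀ {A : Set} (f : ℕ → List A) n {l} → l < n → (∀ {i} → i < n → i ≢ l → f i ≡ []) →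
                        concatMap f (upTo n) ≡ f l
concatMap-upTo-single f (suc n) {l} l<1+n empty = begin
  concatMap f (upTo (suc n))                ≡⟨ concatMap-upTo-suc f n ⟩
  concatMap f (upTo n) ++ f n ++ []         ≡⟨ last (m<1+n⇒m<n∨m≡n l<1+n) ⟩
  f l                                       ∎
  where
  open ≡-Reasoning
  last : l < n ⊎ l ≡ n → concatMap f (upTo n) ++ f n ++ [] ≡ f l
  last (inj₁ l<n) = begin
    concatMap f (upTo n) ++ f n ++ [] ≡⟨ cong₂ (λ xs ys → xs ++ ys ++ [])
                                               (concatMap-upTo-single f n l<n (λ i<n → empty (m<n⇒m<1+n i<n)))
                                               (empty ≤-refl (≢-sym (<⇒≢ l<n))) ⟩
    f l ++ []                         ≡⟨ ++-identityʳ (f l) ⟩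
    f l                               ∎
  last (inj₂ refl) = begin
    concatMap f (upTo n) ++ f n ++ [] ≡⟨ cong (_++ f n ++ []) (concatMap-upTo-[] f n λ i<n → empty (m<n⇒m<1+n i<n) (<⇒≢ i<n)) ⟩
    f n ++ []                         ≡⟨ ++-identityʳ (f n) ⟩
    f n                               ∎

all-concatMap-upTo : ∀ {A : Set} {P : A → Set} (f : ℕ → List A) n → (∀ {i} → i < n → All P (f i)) →
                     All P (concatMap f (upTo n))
all-concatMap-upTo f n all-f = Allₚ.concat⁺ (Allₚ.map⁺ (Allₚ.applyUpTo⁺₁ (λ i → i) n all-f))

offset<11 : ∀ j → {True (j <? 11)} → j < 11
offset<11 j {j<11} = toWitness j<11

vx-injective : ∀ {l i j j′} → j < 11 → j′ < 11 → vx l j ≡ vx i j′ → l ≡ i × j ≡ j′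
vx-injective = *+-injective 11

vx≢vx : ∀ {l i j j′} → j < 11 → j′ < 11 → l ≢ i ⊎ j ≢ j′ → vx l j ≢ vx i j′
vx≢vx {l} {i} j<11 j′<11 (inj₁ l≢i)  eq = l≢i  (proj₁ (vx-injective {l} {i} j<11 j′<11 eq))
vx≢vx {l} {i} j<11 j′<11 (inj₂ j≢j′) eq = j≢j′ (proj₂ (vx-injective {l} {i} j<11 j′<11 eq))

vy2-injective : ∀ {l l′} → vy2 l ≡ vy2 l′ → l ≡ l′
vy2-injective {l} {l′} = proj₁ ∘ vx-injective {l} {l′} (offset<11 9) (offset<11 9)

-- Edge-coloured graphs given by coloured edge lists

ColouredGraph : ℕ → Set
ColouredGraph k = List (Edge × Fin k)

module _ {k : ℕ} where

  open UniqueDec (_≟ᶠ_ {k}) using (Unique; unique?)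

  edgesOf : ColouredGraph k → Graph
  edgesOf = map proj₁

  colouring : (L : ColouredGraph k) → EdgeColoring k (edgesOf L)
  colouring (x ∷ L) zero    = proj₂ x
  colouring (x ∷ L) (suc i) = colouring L i

  coloursAt : ColouredGraph k → ℕ → List (Fin k)
  coloursAt []             w = []
  coloursAt ((e , c) ∷ L) w = if incident w e then c ∷ coloursAt L w else coloursAt L w

  toSubset : List (Fin k) → Subset k
  toSubset = foldr (λ c s → ⁅ c ⁆ ∪ s) ∅

  S-∷ : ∀ e c L w → S (edgesOf ((e , c) ∷ L)) (colouring ((e , c) ∷ L)) w
                  ≡ (if incident w e then ⁅ c ⁆ ∪ S (edgesOf L) (colouring L) w
                                     else S (edgesOf L) (colouring L) w)
  S-∷ e c L w = cong (step zero) (begin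
      foldr step ∅ (tabulate suc)          ≡⟨ cong (foldr step ∅) (map-tabulate (λ i → i) suc) ⟨
      foldr step ∅ (map suc (allFin _))    ≡⟨ foldr-map step suc ∅ (allFin _) ⟩
      S (edgesOf L) (colouring L) w        ∎)
    where
    open ≡-Reasoning
    step = λ f s → if incident w (lookup (edgesOf ((e , c) ∷ L)) f)
                     then ⁅ colouring ((e , c) ∷ L) f ⁆ ∪ s else s

  S≡coloursAt : ∀ L w → S (edgesOf L) (colouring L) w ≡ toSubset (coloursAt L w)
  S≡coloursAt []            w = refl
  S≡coloursAt ((e , c) ∷ L) w rewrite S-∷ e c L w with incident w e
  ... | true  = cong (⁅ c ⁆ ∪_) (S≡coloursAt L w)
  ... | false = S≡coloursAt L w

  -- Colours are collected in lists, not sets, so that a repeated colour at a vertex is detected.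
  LocallyNormal : List (Fin k) → List (Fin k) → Set
  LocallyNormal xs ys = Unique xs × Unique ys × ((n ≡ 3) ⊎ (n ≡ 5))
    where n = ∣ toSubset xs ∪ toSubset ys ∣

  locallyNormal? : ∀ xs ys → Dec (LocallyNormal xs ys)
  locallyNormal? xs ys = unique? xs ×-dec unique? ys ×-dec (n ≟ⁿ 3 ⊎-dec n ≟ⁿ 5)
    where n = ∣ toSubset xs ∪ toSubset ys ∣

  NormalAt : ColouredGraph k → Edge → Set
  NormalAt L (u , v) = LocallyNormal (coloursAt L u) (coloursAt L v)

  incident-fst : ∀ u v → T (incident u (u , v))
  incident-fst u v = Equivalence.from T-∨ (inj₁ (≡⇒≡ᵇ u u refl))

  incident-snd : ∀ u v → T (incident v (u , v))
  incident-snd u v = Equivalence.from T-∨ (inj₂ (≡⇒≡ᵇ v v refl))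

  incident⇒endpoint : ∀ {w u v} → T (incident w (u , v)) → w ≡ u ⊎ w ≡ v
  incident⇒endpoint {w} {u} {v} h with Equivalence.to T-∨ h
  ... | inj₁ p = inj₁ (≡ᵇ⇒≡ w u p)
  ... | inj₂ p = inj₂ (≡ᵇ⇒≡ w v p)

  commonEnd : ∀ e f → SharesEnd e f → ∃[ w ] T (incident w e) × T (incident w f)
  commonEnd (a , b) (_ , b') (inj₁ refl)               = a , incident-fst a b , incident-fst a b'
  commonEnd (a , b) (a' , _) (inj₂ (inj₁ refl))        = a , incident-fst a b , incident-snd a' a
  commonEnd (a , b) (_ , b') (inj₂ (inj₂ (inj₁ refl))) = b , incident-snd a b , incident-fst b b'
  commonEnd (a , b) (a' , _) (inj₂ (inj₂ (inj₂ refl))) = b , incident-snd a b , incident-snd a' b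

  colour∈coloursAt : ∀ L i w → T (incident w (lookup (edgesOf L) i)) → colouring L i ∈ coloursAt L w
  colour∈coloursAt ((e , c) ∷ L) zero w h with incident w e
  ... | true = here refl
  colour∈coloursAt ((e , c) ∷ L) (suc i) w h with incident w e
  ... | true  = there (colour∈coloursAt L i w h)
  ... | false = colour∈coloursAt L i w h

  unique-tail : ∀ e c L w → Unique (coloursAt ((e , c) ∷ L) w) → Unique (coloursAt L w)
  unique-tail e c L w u with incident w e | u
  ... | true  | _ ∷ u′ = u′
  ... | false | u′     = u′

  unique-head : ∀ e c L w → T (incident w e) → Unique (coloursAt ((e , c) ∷ L) w) → All (c ≢_) (coloursAt L w)
  unique-head e c L w h u with incident w e | u
  ... | true | fresh ∷ _ = fresh

  unique⇒proper : ∀ L → (∀ i w → T (incident w (lookup (edgesOf L) i)) → Unique (coloursAt L w)) →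
                   Proper (edgesOf L) (colouring L)
  unique⇒proper (x ∷ L) U zero zero i≢j _ = ⊥-elim (i≢j refl)
  unique⇒proper ((e , c) ∷ L) U zero (suc j) _ shared with commonEnd _ _ shared
  ... | w , he , hf = All.lookup (unique-head e c L w he (U zero w he)) (colour∈coloursAt L j w hf)
  unique⇒proper ((e , c) ∷ L) U (suc i) zero _ shared with commonEnd _ _ shared
  ... | w , he , hf = ≢-sym (All.lookup (unique-head e c L w hf (U zero w hf)) (colour∈coloursAt L i w he))
  unique⇒proper ((e , c) ∷ L) U (suc i) (suc j) i≢j =
    unique⇒proper L (λ i′ w h → unique-tail e c L w (U (suc i′) w h)) i j (i≢j ∘ cong suc)

  unique-endpoint : ∀ L e w → T (incident w e) → NormalAt L e → Unique (coloursAt L w)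
  unique-endpoint L (u , v) w h (Uu , Uv , _) with incident⇒endpoint {w} {u} {v} h
  ... | inj₁ refl = Uu
  ... | inj₂ refl = Uv

  normalEdge : ∀ L e → NormalAt L e → NormalEdge (edgesOf L) (colouring L) e
  normalEdge L (u , v) (_ , _ , size) rewrite S≡coloursAt L u | S≡coloursAt L v = size

  normalColouring : ∀ L → All (NormalAt L) (edgesOf L) → NormalColoring k (edgesOf L) (colouring L)
  normalColouring L N =
      unique⇒proper L (λ i w h → unique-endpoint L _ w h (normalAt i))
    , (λ i → normalEdge L _ (normalAt i))
    where
    normalAt : ∀ i → NormalAt L (lookup (edgesOf L) i)
    normalAt i = All.lookup N (∈-lookup i)

  coloursAt-++ : ∀ L M w → coloursAt (L ++ M) w ≡ coloursAt L w ++ coloursAt M w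
  coloursAt-++ []            M w = refl
  coloursAt-++ ((e , c) ∷ L) M w with incident w e
  ... | true  = cong (c ∷_) (coloursAt-++ L M w)
  ... | false = coloursAt-++ L M w

  coloursAt-concatMap : ∀ {A : Set} (f : A → ColouredGraph k) xs w →
                        coloursAt (concatMap f xs) w ≡ concatMap (λ x → coloursAt (f x) w) xs
  coloursAt-concatMap f []       w = refl
  coloursAt-concatMap f (x ∷ xs) w =
    trans (coloursAt-++ (f x) _ w) (cong (coloursAt (f x) w ++_) (coloursAt-concatMap f xs w))

  coloursAt-away : ∀ {w u v} c L → w ≢ u → w ≢ v → coloursAt (((u , v) , c) ∷ L) w ≡ coloursAt L w
  coloursAt-away {w} {u} {v} c L w≢u w≢v with incident w (u , v) | incident⇒endpoint {w} {u} {v}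
  ... | false | _        = refl
  ... | true  | endpoint with endpoint _
  ...   | inj₁ w≡u = ⊥-elim (w≢u w≡u)
  ...   | inj₂ w≡v = ⊥-elim (w≢v w≡v)

  coloursAt-fst : ∀ {w v} c L → coloursAt (((w , v) , c) ∷ L) w ≡ c ∷ coloursAt L w
  coloursAt-fst {w} {v} c L with incident w (w , v) | incident-fst w v
  ... | true | _ = refl

  coloursAt-snd : ∀ {u w} c L → coloursAt (((u , w) , c) ∷ L) w ≡ c ∷ coloursAt L w
  coloursAt-snd {u} {w} c L with incident w (u , w) | incident-snd u w
  ... | true | _ = refl

  translate : ℕ → ColouredGraph k → ColouredGraph k
  translate x = map λ where ((a , b) , c) → (x + a , x + b) , c

  coloursAt-translate : ∀ x L j → coloursAt (translate x L) (x + j) ≡ coloursAt L j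
  coloursAt-translate x []                  j = refl
  coloursAt-translate x (((a , b) , c) ∷ L) j rewrite +-cancelˡ-≡ᵇ x j a | +-cancelˡ-≡ᵇ x j b
    with incident j (a , b)
  ... | true  = cong (c ∷_) (coloursAt-translate x L j)
  ... | false = coloursAt-translate x L j

  coloursAt-translate-outside : ∀ x d L w → All (λ e → proj₁ (proj₁ e) < d × proj₂ (proj₁ e) < d) L →
                                (∀ {a} → a < d → w ≢ x + a) → coloursAt (translate x L) w ≡ []
  coloursAt-translate-outside x d []                  w []                     away = refl
  coloursAt-translate-outside x d (((a , b) , c) ∷ L) w ((a<d , b<d) ∷ small) away =
    trans (coloursAt-away c (translate x L) (away a<d) (away b<d))
          (coloursAt-translate-outside x d L w small away)

-- A proper 3-edge-colouring of the cubic tree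

rotate : Fin 3 → Fin 3
rotate zero             = suc zero
rotate (suc zero)       = suc (suc zero)
rotate (suc (suc zero)) = zero

colour : Fin 3 → Fin 6
colour χ = χ ↑ˡ 3

innerColours : Fin 3 → List (Fin 6)
innerColours χ = colour χ ∷ colour (rotate χ) ∷ colour (rotate (rotate χ)) ∷ []

nInner : BTree → ℕ
nInner lf       = 0
nInner (nd a b) = suc (nInner a + nInner b)

leafColour : BTree → Fin 3 → ℕ → ℕ → Fin 3
leafColour lf       χ li l = χ
leafColour (nd a b) χ li l with l <? li + nLeaves a
... | yes _ = leafColour a (rotate χ) li l
... | no  _ = leafColour b (rotate (rotate χ)) (li + nLeaves a) l

module TreeColouring (base : ℕ) where

  -- Arguments as for treeEdges, followed by the colour of the edge to the parent.
  treeColouring : BTree → ℕ → ℕ → ℕ → Fin 3 → ColouredGraph 6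
  children      : BTree → BTree → ℕ → ℕ → Fin 3 → ColouredGraph 6
  treeColouring lf       p li ni χ = ((p , vy2 li) , colour χ) ∷ []
  treeColouring (nd a b) p li ni χ = ((p , base + ni) , colour χ) ∷ children a b li ni χ

  children a b li ni χ = treeColouring a (base + ni) li (suc ni) (rotate χ)
                      ++ treeColouring b (base + ni) (li + nLeaves a) (suc ni + nInner a) (rotate (rotate χ))

  treeEdges≡ : ∀ T p li ni χ →
               treeEdges base T p li ni ≡ (edgesOf (treeColouring T p li ni χ) , li + nLeaves T , ni + nInner T)
  treeEdges≡ lf p li ni χ = cong₂ (λ l i → (p , vy2 li) ∷ [] , l , i) (+-comm 1 li) (sym (+-identityʳ ni))
  treeEdges≡ (nd a b) p li ni χ
    rewrite treeEdges≡ a (base + ni) li (suc ni) (rotate χ)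
          | treeEdges≡ b (base + ni) (li + nLeaves a) (suc ni + nInner a) (rotate (rotate χ))
          | map-++ proj₁ (treeColouring a (base + ni) li (suc ni) (rotate χ))
                         (treeColouring b (base + ni) (li + nLeaves a) (suc ni + nInner a) (rotate (rotate χ)))
          | +-assoc li (nLeaves a) (nLeaves b)
          | +-suc ni (nInner a + nInner b)
          | +-assoc ni (nInner a) (nInner b) = refl

  record Inner (ni : ℕ) (T : BTree) (w : ℕ) : Set where
    constructor inner
    field
      k       : ℕ
      inRange : InRange ni (nInner T) k
      vertex  : w ≡ base + k

  record Leaf (li : ℕ) (T : BTree) (w : ℕ) : Set where
    constructor leaf
    field
      l       : ℕ
      inRange : InRange li (nLeaves T) l
      vertex  : w ≡ vy2 l

  Separated : ℕ → ℕ → BTree → Set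
  Separated li ni T = ∀ {w} → Inner ni T w → ¬ Leaf li T w

  root∉left : ∀ {ni a} → ¬ Inner (suc ni) a (base + ni)
  root∉left {ni} (inner k r eq) with refl ← +-cancelˡ-≡ base ni k eq = inRange-below ≤-refl r

  module _ {ni : ℕ} {a b : BTree} where

    inner-root : ∀ {w} → w ≡ base + ni → Inner ni (nd a b) w
    inner-root eq = inner ni (inRange-lo ni _) eq

    inner-left : ∀ {w} → Inner (suc ni) a w → Inner ni (nd a b) w
    inner-left (inner k r eq) = inner k (inRange-suc⁺ (inRange-+ˡ r)) eq

    inner-right : ∀ {w} → Inner (suc ni + nInner a) b w → Inner ni (nd a b) w
    inner-right (inner k r eq) = inner k (inRange-suc⁺ (inRange-+ʳ r)) eq

    inner-split : ∀ {w} → Inner ni (nd a b) w → w ≡ base + ni ⊎ Inner (suc ni) a w ⊎ Inner (suc ni + nInner a) b w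
    inner-split (inner k r eq) with inRange-suc⁻ r
    ... | inj₁ refl = inj₁ eq
    ... | inj₂ r′ with inRange-split r′
    ...   | inj₁ ra = inj₂ (inj₁ (inner k ra eq))
    ...   | inj₂ rb = inj₂ (inj₂ (inner k rb eq))

    root∉right : ¬ Inner (suc ni + nInner a) b (base + ni)
    root∉right (inner k r eq) with refl ← +-cancelˡ-≡ base ni k eq = inRange-below (s≤s (m≤m+n ni (nInner a))) r

    left∉right : ∀ {w} → Inner (suc ni) a w → ¬ Inner (suc ni + nInner a) b w
    left∉right (inner k ra refl) (inner k′ rb eq) with refl ← +-cancelˡ-≡ base k k′ eq = inRange-disjoint ra rb

  module _ {li : ℕ} {a b : BTree} where

    leaf-left : ∀ {w} → Leaf li a w → Leaf li (nd a b) w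
    leaf-left (leaf l r eq) = leaf l (inRange-+ˡ r) eq

    leaf-right : ∀ {w} → Leaf (li + nLeaves a) b w → Leaf li (nd a b) w
    leaf-right (leaf l r eq) = leaf l (inRange-+ʳ r) eq

    leftLeaf∉right : ∀ {w} → Leaf li a w → ¬ Leaf (li + nLeaves a) b w
    leftLeaf∉right (leaf l ra eq) (leaf l′ rb eq′) =
      inRange-disjoint ra (subst (InRange _ _) (vy2-injective {l′} {l} (trans (sym eq′) eq)) rb)

  module _ {ni li : ℕ} {a b : BTree} where

    separated-left : Separated li ni (nd a b) → Separated li (suc ni) a
    separated-left sep i l = sep (inner-left i) (leaf-left l)

    separated-right : Separated li ni (nd a b) → Separated (li + nLeaves a) (suc ni + nInner a) b
    separated-right sep i l = sep (inner-right i) (leaf-right l)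

  coloursAt-tree-away : ∀ T p li ni χ {w} → w ≢ p → ¬ Inner ni T w → ¬ Leaf li T w →
                        coloursAt (treeColouring T p li ni χ) w ≡ []
  coloursAt-children-away : ∀ a b li ni χ {w} → ¬ Inner ni (nd a b) w → ¬ Leaf li (nd a b) w →
                            coloursAt (children a b li ni χ) w ≡ []

  coloursAt-tree-away lf p li ni χ w≢p _ ∉leaves =
    coloursAt-away (colour χ) [] w≢p (λ eq → ∉leaves (leaf li (inRange-lo li 0) eq))
  coloursAt-tree-away (nd a b) p li ni χ w≢p ∉inner ∉leaves =
    trans (coloursAt-away (colour χ) (children a b li ni χ) w≢p (∉inner ∘ inner-root))
          (coloursAt-children-away a b li ni χ ∉inner ∉leaves)

  coloursAt-children-away a b li ni χ {w} ∉inner ∉leaves =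
    trans (coloursAt-++ (treeColouring a (base + ni) li (suc ni) (rotate χ))
                        (treeColouring b (base + ni) (li + nLeaves a) (suc ni + nInner a) (rotate (rotate χ))) w)
          (cong₂ _++_
            (coloursAt-tree-away a (base + ni) li (suc ni) (rotate χ)
               (∉inner ∘ inner-root) (∉inner ∘ inner-left) (∉leaves ∘ leaf-left))
            (coloursAt-tree-away b (base + ni) (li + nLeaves a) (suc ni + nInner a) (rotate (rotate χ))
               (∉inner ∘ inner-root) (∉inner ∘ inner-right) (∉leaves ∘ leaf-right)))

  coloursAt-tree-parent : ∀ T p li ni χ → ¬ Inner ni T p → ¬ Leaf li T p →
                          coloursAt (treeColouring T p li ni χ) p ≡ colour χ ∷ []
  coloursAt-tree-parent lf       p li ni χ _      _       = coloursAt-fst {w = p} (colour χ) []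
  coloursAt-tree-parent (nd a b) p li ni χ ∉inner ∉leaves =
    trans (coloursAt-fst (colour χ) (children a b li ni χ))
          (cong (colour χ ∷_) (coloursAt-children-away a b li ni χ ∉inner ∉leaves))

  coloursAt-tree-inner : ∀ T p li ni χ {w} → Separated li ni T → Inner ni T w → w ≢ p →
                         ∃[ χ′ ] coloursAt (treeColouring T p li ni χ) w ≡ innerColours χ′
  coloursAt-tree-inner lf p li ni χ _ (inner k r _) _ = ⊥-elim (inRange-empty r)
  coloursAt-tree-inner (nd a b) p li ni χ {w} sep inT w≢p with inner-split inT
  ... | inj₁ refl = χ , (begin
    coloursAt (treeColouring (nd a b) p li ni χ) r        ≡⟨ coloursAt-snd (colour χ) (children a b li ni χ) ⟩
    colour χ ∷ coloursAt (A ++ B) r                       ≡⟨ cong (colour χ ∷_) (coloursAt-++ A B r) ⟩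
    colour χ ∷ coloursAt A r ++ coloursAt B r             ≡⟨ cong₂ (λ xs ys → colour χ ∷ xs ++ ys)
         (coloursAt-tree-parent a r li (suc ni) (rotate χ) root∉left (λ l → sep (inner-root refl) (leaf-left l)))
         (coloursAt-tree-parent b r (li + nLeaves a) (suc ni + nInner a) (rotate (rotate χ))
            root∉right (λ l → sep (inner-root refl) (leaf-right l))) ⟩
    innerColours χ                                        ∎)
    where
    open ≡-Reasoning
    r = base + ni
    A = treeColouring a r li (suc ni) (rotate χ)
    B = treeColouring b r (li + nLeaves a) (suc ni + nInner a) (rotate (rotate χ))
  ... | inj₂ (inj₁ inA) with coloursAt-tree-inner a (base + ni) li (suc ni) (rotate χ) (separated-left sep) inA w≢r
    where w≢r = λ eq → root∉left (subst (Inner (suc ni) a) eq inA)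
  ...   | χ′ , colours-a = χ′ , (begin
    coloursAt (treeColouring (nd a b) p li ni χ) w   ≡⟨ coloursAt-away (colour χ) (A ++ B) w≢p w≢r ⟩
    coloursAt (A ++ B) w                             ≡⟨ coloursAt-++ A B w ⟩
    coloursAt A w ++ coloursAt B w                   ≡⟨ cong₂ _++_ colours-a
         (coloursAt-tree-away b r (li + nLeaves a) (suc ni + nInner a) (rotate (rotate χ))
            w≢r (left∉right inA) (sep (inner-left inA) ∘ leaf-right)) ⟩
    innerColours χ′ ++ []                            ≡⟨ ++-identityʳ _ ⟩
    innerColours χ′                                  ∎)
    where
    open ≡-Reasoning
    r = base + ni
    A = treeColouring a r li (suc ni) (rotate χ)
    B = treeColouring b r (li + nLeaves a) (suc ni + nInner a) (rotate (rotate χ))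
    w≢r = λ eq → root∉left (subst (Inner (suc ni) a) eq inA)
  coloursAt-tree-inner (nd a b) p li ni χ {w} sep inT w≢p | inj₂ (inj₂ inB)
    with coloursAt-tree-inner b (base + ni) (li + nLeaves a) (suc ni + nInner a) (rotate (rotate χ)) (separated-right sep) inB w≢r
    where w≢r = λ eq → root∉right (subst (Inner (suc ni + nInner a) b) eq inB)
  ...   | χ′ , colours-b = χ′ , (begin
    coloursAt (treeColouring (nd a b) p li ni χ) w   ≡⟨ coloursAt-away (colour χ) (A ++ B) w≢p w≢r ⟩
    coloursAt (A ++ B) w                             ≡⟨ coloursAt-++ A B w ⟩
    coloursAt A w ++ coloursAt B w                   ≡⟨ cong (_++ coloursAt B w)
         (coloursAt-tree-away a r li (suc ni) (rotate χ)
            w≢r (λ inA → left∉right inA inB) (sep (inner-right inB) ∘ leaf-left)) ⟩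
    coloursAt B w                                    ≡⟨ colours-b ⟩
    innerColours χ′                                  ∎)
    where
    open ≡-Reasoning
    r = base + ni
    A = treeColouring a r li (suc ni) (rotate χ)
    B = treeColouring b r (li + nLeaves a) (suc ni + nInner a) (rotate (rotate χ))
    w≢r = λ eq → root∉right (subst (Inner (suc ni + nInner a) b) eq inB)

  coloursAt-tree-leaf : ∀ T p li ni χ {l} → Separated li ni T → InRange li (nLeaves T) l → vy2 l ≢ p →
                        coloursAt (treeColouring T p li ni χ) (vy2 l) ≡ colour (leafColour T χ li l) ∷ []
  coloursAt-tree-leaf lf p li ni χ _ r _ with refl ← inRange-single r = coloursAt-snd {u = p} {w = vy2 li} (colour χ) []
  coloursAt-tree-leaf (nd a b) p li ni χ {l} sep r l≢p with l <? li + nLeaves a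
  ... | yes l<mid = begin
    coloursAt (treeColouring (nd a b) p li ni χ) (vy2 l)   ≡⟨ coloursAt-away (colour χ) (A ++ B) l≢p l≢r ⟩
    coloursAt (A ++ B) (vy2 l)                             ≡⟨ coloursAt-++ A B (vy2 l) ⟩
    coloursAt A (vy2 l) ++ coloursAt B (vy2 l)             ≡⟨ cong₂ _++_
         (coloursAt-tree-leaf a (base + ni) li (suc ni) (rotate χ) (separated-left sep) inA l≢r)
         (coloursAt-tree-away b (base + ni) (li + nLeaves a) (suc ni + nInner a) (rotate (rotate χ))
            l≢r (λ i → sep (inner-right i) leafT) (leftLeaf∉right {a = a} (leaf l inA refl))) ⟩
    colour (leafColour a (rotate χ) li l) ∷ [] ++ []       ≡⟨ ++-identityʳ _ ⟩
    colour (leafColour a (rotate χ) li l) ∷ []             ∎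
    where
    open ≡-Reasoning
    A = treeColouring a (base + ni) li (suc ni) (rotate χ)
    B = treeColouring b (base + ni) (li + nLeaves a) (suc ni + nInner a) (rotate (rotate χ))
    leafT = leaf l r refl
    l≢r : vy2 l ≢ base + ni
    l≢r eq = sep (inner-root eq) leafT
    inA = proj₁ r , l<mid
  ... | no l≮mid = begin
    coloursAt (treeColouring (nd a b) p li ni χ) (vy2 l)   ≡⟨ coloursAt-away (colour χ) (A ++ B) l≢p l≢r ⟩
    coloursAt (A ++ B) (vy2 l)                             ≡⟨ coloursAt-++ A B (vy2 l) ⟩
    coloursAt A (vy2 l) ++ coloursAt B (vy2 l)             ≡⟨ cong (_++ coloursAt B (vy2 l))
         (coloursAt-tree-away a (base + ni) li (suc ni) (rotate χ)
            l≢r (λ i → sep (inner-left i) leafT) (λ inLeft → leftLeaf∉right {b = b} inLeft (leaf l inB refl))) ⟩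
    coloursAt B (vy2 l)                                    ≡⟨ coloursAt-tree-leaf b (base + ni) (li + nLeaves a) (suc ni + nInner a)
                                                               (rotate (rotate χ)) (separated-right sep) inB l≢r ⟩
    colour (leafColour b (rotate (rotate χ)) (li + nLeaves a) l) ∷ [] ∎
    where
    open ≡-Reasoning
    A = treeColouring a (base + ni) li (suc ni) (rotate χ)
    B = treeColouring b (base + ni) (li + nLeaves a) (suc ni + nInner a) (rotate (rotate χ))
    leafT = leaf l r refl
    l≢r : vy2 l ≢ base + ni
    l≢r eq = sep (inner-root eq) leafT
    inB = ≮⇒≥ l≮mid , subst (l <_) (sym (+-assoc li (nLeaves a) (nLeaves b))) (proj₂ r)

  TreeEdge : ℕ → ℕ → ℕ → BTree → Edge → Set
  TreeEdge p li ni T (u , v) = (u ≡ p ⊎ Inner ni T u) × (Inner ni T v ⊎ Leaf li T v)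

  treeColouring-edges : ∀ T p li ni χ → All (TreeEdge p li ni T ∘ proj₁) (treeColouring T p li ni χ)
  treeColouring-edges lf       p li ni χ = (inj₁ refl , inj₂ (leaf li (inRange-lo li 0) refl)) ∷ []
  treeColouring-edges (nd a b) p li ni χ =
    (inj₁ refl , inj₁ (inner-root refl))
    ∷ Allₚ.++⁺ (All.map (λ {x} → liftLeft (proj₁ x)) (treeColouring-edges a (base + ni) li (suc ni) (rotate χ)))
              (All.map (λ {x} → liftRight (proj₁ x))
                 (treeColouring-edges b (base + ni) (li + nLeaves a) (suc ni + nInner a) (rotate (rotate χ))))
    where
    liftLeft : ∀ e → TreeEdge (base + ni) li (suc ni) a e → TreeEdge p li ni (nd a b) e
    liftLeft (u , v) (end₁ , end₂) = inj₂ (Sum.[ inner-root , inner-left ]′ end₁) , Sum.map inner-left leaf-left end₂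
    liftRight : ∀ e → TreeEdge (base + ni) (li + nLeaves a) (suc ni + nInner a) b e → TreeEdge p li ni (nd a b) e
    liftRight (u , v) (end₁ , end₂) = inj₂ (Sum.[ inner-root , inner-right ]′ end₁) , Sum.map inner-right leaf-right end₂

-- The colourings of the copies of P₀ and the finite checks

decideAll : ∀ {n} {P : Fin n → Set} (P? : ∀ i → Dec (P i)) → {True (Finₚ.all? P?)} → ∀ i → P i
decideAll P? {ok} = toWitness ok

p0Edges : List Edge
p0Edges = (0 , 1) ∷ (0 , 3) ∷ (1 , 2) ∷ (1 , 6) ∷ (2 , 4) ∷ (3 , 4) ∷ (3 , 5) ∷ (4 , 7)
        ∷ (5 , 6) ∷ (6 , 7) ∷ (0 , 8) ∷ (8 , 9) ∷ (9 , 10) ∷ (7 , 10) ∷ []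

-- With colour χ on b₃, colour 0 on b₂, b₄ and colour 1 on b₁, b₅ these colourings of p0Edges are normal.
p0Colours : Fin 3 → List (Fin 6)
p0Colours zero             = # 1 ∷ # 0 ∷ # 3 ∷ # 4 ∷ # 5 ∷ # 4 ∷ # 3 ∷ # 1 ∷ # 5 ∷ # 2 ∷ # 2 ∷ # 1 ∷ # 2 ∷ # 0 ∷ []
p0Colours (suc zero)       = # 2 ∷ # 0 ∷ # 3 ∷ # 4 ∷ # 5 ∷ # 4 ∷ # 3 ∷ # 1 ∷ # 5 ∷ # 0 ∷ # 1 ∷ # 2 ∷ # 0 ∷ # 2 ∷ []
p0Colours (suc (suc zero)) = # 1 ∷ # 0 ∷ # 3 ∷ # 4 ∷ # 5 ∷ # 4 ∷ # 3 ∷ # 1 ∷ # 5 ∷ # 0 ∷ # 2 ∷ # 1 ∷ # 0 ∷ # 2 ∷ []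

p0Colouring : Fin 3 → ColouredGraph 6
p0Colouring χ = zip p0Edges (p0Colours χ)

treeEdgeColours : Fin 3 → ℕ → List (Fin 6)
treeEdgeColours χ j with j ≟ⁿ 9
... | yes _ = colour χ ∷ []
... | no  _ = []

-- The semi-edges b₄ at x₃ and b₂ at y₁ lie on connectors of colour 0, b₅ at x₆ and b₁ at y₃ on connectors of colour 1.
connectorColours : ℕ → List (Fin 6)
connectorColours j with j ≟ⁿ 2 | j ≟ⁿ 5 | j ≟ⁿ 8 | j ≟ⁿ 10
... | yes _ | _     | _     | _     = # 0 ∷ []
... | no  _ | yes _ | _     | _     = # 1 ∷ []
... | no  _ | no  _ | yes _ | _     = # 0 ∷ []
... | no  _ | no  _ | no  _ | yes _ = # 1 ∷ []
... | no  _ | no  _ | no  _ | no  _ = []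

copyColours : Fin 3 → ℕ → List (Fin 6)
copyColours χ j = treeEdgeColours χ j ++ coloursAt (p0Colouring χ) j ++ connectorColours j

CopyEdgeNormal : Fin 3 → Edge → Set
CopyEdgeNormal χ (a , b) = a < 11 × b < 11 × LocallyNormal (copyColours χ a) (copyColours χ b)

copyEdges-normal : ∀ χ → All (CopyEdgeNormal χ ∘ proj₁) (p0Colouring χ)
copyEdges-normal = decideAll λ χ → All.all? (λ x → check χ (proj₁ x)) (p0Colouring χ)
  where
  check : ∀ χ e → Dec (CopyEdgeNormal χ e)
  check χ (a , b) = a <? 11 ×-dec b <? 11 ×-dec locallyNormal? (copyColours χ a) (copyColours χ b)

p0Colouring-bounded : ∀ χ → All (λ x → proj₁ (proj₁ x) < 11 × proj₂ (proj₁ x) < 11) (p0Colouring χ)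
p0Colouring-bounded χ = All.map (λ {x} → bounds (proj₁ x)) (copyEdges-normal χ)
  where
  bounds : ∀ e → CopyEdgeNormal χ e → proj₁ e < 11 × proj₂ e < 11
  bounds (a , b) (a<11 , b<11 , _) = a<11 , b<11

locallyNormal-all : (f g : Fin 3 → List (Fin 6)) →
                    {True (Finₚ.all? λ χ → Finₚ.all? λ χ′ → locallyNormal? (f χ) (g χ′))} →
                    ∀ χ χ′ → LocallyNormal (f χ) (g χ′)
locallyNormal-all f g {ok} = toWitness ok

treeEndColours : Fin 3 ⊎ Fin 3 → List (Fin 6)
treeEndColours = Sum.[ innerColours , (λ χ → copyColours χ 9) ]′

treeEdge-normal : ∀ s t → LocallyNormal (treeEndColours s) (treeEndColours t)
treeEdge-normal (inj₁ χ) (inj₁ χ′) = locallyNormal-all innerColours innerColours χ χ′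
treeEdge-normal (inj₁ χ) (inj₂ χ′) = locallyNormal-all innerColours (λ χ → copyColours χ 9) χ χ′
treeEdge-normal (inj₂ χ) (inj₁ χ′) = locallyNormal-all (λ χ → copyColours χ 9) innerColours χ χ′
treeEdge-normal (inj₂ χ) (inj₂ χ′) = locallyNormal-all (λ χ → copyColours χ 9) (λ χ → copyColours χ 9) χ χ′

connector-normal : ∀ χ χ′ → LocallyNormal (copyColours χ 2) (copyColours χ′ 8)
                          × LocallyNormal (copyColours χ 5) (copyColours χ′ 10)
connector-normal χ χ′ = locallyNormal-all (λ χ → copyColours χ 2) (λ χ → copyColours χ 8) χ χ′
                      , locallyNormal-all (λ χ → copyColours χ 5) (λ χ → copyColours χ 10) χ χ′

-- The normal 6-edge-colouring of G(T, C)

module Snark (a b : BTree) where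

  n base : ℕ
  n    = suc (nLeaves a + nLeaves b)
  base = 11 * n

  open TreeColouring base

  -- Copy 0 sits at the leaf l₁, whose tree edge leads to the root of nd a b.
  copyColour : ℕ → Fin 3
  copyColour zero    = zero
  copyColour (suc l) = leafColour (nd a b) zero 1 (suc l)

  next : ℕ → ℕ
  next i = suc i % n

  treePart : ColouredGraph 6
  treePart = treeColouring (nd a b) (vy2 0) 1 0 zero

  copy : ℕ → ColouredGraph 6
  copy i = translate (11 * i) (p0Colouring (copyColour i))

  connector : ℕ → ColouredGraph 6
  connector i = ((vx i 2 , vy1 (next i)) , # 0) ∷ ((vx i 5 , vy3 (next i)) , # 1) ∷ []

  copies connectors snarkColouring : ColouredGraph 6
  copies         = concatMap copy (upTo n)
  connectors     = concatMap connector (upTo n)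
  snarkColouring = treePart ++ copies ++ connectors

  edgesOf-snarkColouring : edgesOf snarkColouring ≡ treelikeSnark a b
  edgesOf-snarkColouring = begin
    edgesOf (treePart ++ copies ++ connectors)                    ≡⟨ map-++ proj₁ treePart _ ⟩
    edgesOf treePart ++ edgesOf (copies ++ connectors)            ≡⟨ cong (edgesOf treePart ++_) (map-++ proj₁ copies connectors) ⟩
    edgesOf treePart ++ edgesOf copies ++ edgesOf connectors      ≡⟨ cong₂ _++_ tree (cong₂ _++_ copies-edges (map-concatMap proj₁ connector (upTo n))) ⟩
    treelikeSnark a b                                             ∎
    where
    open ≡-Reasoning
    tree : edgesOf treePart ≡ proj₁ (treeEdges base (nd a b) (vy2 0) 1 0)
    tree = sym (cong proj₁ (treeEdges≡ (nd a b) (vy2 0) 1 0 zero))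
    copy-edges : ∀ i χ → edgesOf (translate (11 * i) (p0Colouring χ)) ≡ P0edges i
    copy-edges i zero             = refl
    copy-edges i (suc zero)       = refl
    copy-edges i (suc (suc zero)) = refl
    copies-edges : edgesOf copies ≡ concatMap P0edges (upTo n)
    copies-edges = trans (map-concatMap proj₁ copy (upTo n)) (concatMap-cong (λ i → copy-edges i (copyColour i)) (upTo n))

  vx<inner : ∀ {i j} k → i < n → j < 11 → vx i j < base + k
  vx<inner {i} {j} k i<n j<11 = begin-strict
    11 * i + j    <⟨ +-monoʳ-< (11 * i) j<11 ⟩
    11 * i + 11   ≡⟨ +-comm (11 * i) 11 ⟩
    11 + 11 * i   ≡⟨ *-suc 11 i ⟨
    11 * suc i    ≤⟨ *-monoʳ-≤ 11 i<n ⟩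
    base          ≤⟨ m≤m+n base k ⟩
    base + k      ∎
    where open ≤-Reasoning

  inner≢vx : ∀ {i j} k → i < n → j < 11 → base + k ≢ vx i j
  inner≢vx k i<n j<11 eq = <⇒≢ (vx<inner k i<n j<11) (sym eq)

  offsets≢ : ∀ l i j j′ {j<11 : True (j <? 11)} {j′<11 : True (j′ <? 11)} → j ≢ j′ → vx l j ≢ vx i j′
  offsets≢ l i j j′ {j<11} {j′<11} j≢j′ = vx≢vx {l} {i} (toWitness j<11) (toWitness j′<11) (inj₂ j≢j′)

  separated : Separated 1 0 (nd a b)
  separated (inner k _ refl) (leaf l (_ , l<n) eq) = inner≢vx k l<n (offset<11 9) eq

  copyVertex∉inner : ∀ {l j} → l < n → j < 11 → ¬ Inner 0 (nd a b) (vx l j)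
  copyVertex∉inner l<n j<11 (inner k _ eq) = inner≢vx k l<n j<11 (sym eq)

  coloursAt-treePart-copy : ∀ {l j} → l < n → j < 11 → coloursAt treePart (vx l j) ≡ treeEdgeColours (copyColour l) j
  coloursAt-treePart-copy {l} {j} l<n j<11 with j ≟ⁿ 9
  ... | no j≢9 = coloursAt-tree-away (nd a b) (vy2 0) 1 0 zero
                   (vx≢vx {l} {0} j<11 (offset<11 9) (inj₂ j≢9)) (copyVertex∉inner l<n j<11) ∉leaves
    where
    ∉leaves : ¬ Leaf 1 (nd a b) (vx l j)
    ∉leaves (leaf l′ _ eq) = j≢9 (proj₂ (vx-injective {l} {l′} j<11 (offset<11 9) eq))
  ... | yes refl with l
  ...   | zero   = coloursAt-tree-parent (nd a b) (vy2 0) 1 0 zero (copyVertex∉inner l<n j<11) ∉leaves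
    where
    ∉leaves : ¬ Leaf 1 (nd a b) (vy2 0)
    ∉leaves (leaf l′ (0<l′ , _) eq) = <⇒≢ 0<l′ (vy2-injective {0} {l′} eq)
  ...   | suc l′ = coloursAt-tree-leaf (nd a b) (vy2 0) 1 0 zero separated (s≤s z≤n , l<n)
                     (λ eq → 1+n≢0 (vy2-injective {suc l′} {0} eq))

  coloursAt-copies : ∀ {l j} → l < n → j < 11 → coloursAt copies (vx l j) ≡ coloursAt (p0Colouring (copyColour l)) j
  coloursAt-copies {l} {j} l<n j<11 = begin
    coloursAt copies (vx l j)                               ≡⟨ coloursAt-concatMap copy (upTo n) (vx l j) ⟩
    concatMap (λ i → coloursAt (copy i) (vx l j)) (upTo n)  ≡⟨ concatMap-upTo-single _ n l<n other ⟩
    coloursAt (copy l) (vx l j)                             ≡⟨ coloursAt-translate (11 * l) (p0Colouring (copyColour l)) j ⟩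
    coloursAt (p0Colouring (copyColour l)) j                ∎
    where
    open ≡-Reasoning
    other : ∀ {i} → i < n → i ≢ l → coloursAt (copy i) (vx l j) ≡ []
    other {i} _ i≢l = coloursAt-translate-outside (11 * i) 11 (p0Colouring (copyColour i)) (vx l j) (p0Colouring-bounded (copyColour i))
                        (λ a<11 → vx≢vx j<11 a<11 (inj₁ (≢-sym i≢l)))

  connector-away : ∀ i {w} → w ≢ vx i 2 → w ≢ vy1 (next i) → w ≢ vx i 5 → w ≢ vy3 (next i) →
                   coloursAt (connector i) w ≡ []
  connector-away i {w} x₃ y₁ x₆ y₃ =
    trans (coloursAt-away {w = w} {u = vx i 2} {v = vy1 (next i)} (# 0) (((vx i 5 , vy3 (next i)) , # 1) ∷ []) x₃ y₁)
          (coloursAt-away {w = w} {u = vx i 5} {v = vy3 (next i)} (# 1) [] x₆ y₃)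

  copyVertex-connector-away : ∀ i l {j} → j < 11 → l ≢ i ⊎ j ≢ 2 → l ≢ next i ⊎ j ≢ 8 → l ≢ i ⊎ j ≢ 5 → l ≢ next i ⊎ j ≢ 10 →
                              coloursAt (connector i) (vx l j) ≡ []
  copyVertex-connector-away i l j<11 x₃ y₁ x₆ y₃ =
    connector-away i (vx≢vx j<11 (offset<11 2) x₃) (vx≢vx j<11 (offset<11 8) y₁)
                     (vx≢vx j<11 (offset<11 5) x₆) (vx≢vx j<11 (offset<11 10) y₃)

  coloursAt-connector-x₃ : ∀ i → coloursAt (connector i) (vx i 2) ≡ # 0 ∷ []
  coloursAt-connector-x₃ i =
    trans (coloursAt-fst {w = vx i 2} (# 0) (((vx i 5 , vy3 (next i)) , # 1) ∷ []))
          (cong (# 0 ∷_) (coloursAt-away {w = vx i 2} {u = vx i 5} {v = vy3 (next i)} (# 1) []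
                            (offsets≢ i i 2 5 λ ()) (offsets≢ i (next i) 2 10 λ ())))

  coloursAt-connector-x₆ : ∀ i → coloursAt (connector i) (vx i 5) ≡ # 1 ∷ []
  coloursAt-connector-x₆ i =
    trans (coloursAt-away {w = vx i 5} {u = vx i 2} {v = vy1 (next i)} (# 0) (((vx i 5 , vy3 (next i)) , # 1) ∷ [])
             (offsets≢ i i 5 2 λ ()) (offsets≢ i (next i) 5 8 λ ()))
          (coloursAt-fst {w = vx i 5} (# 1) [])

  coloursAt-connector-y₁ : ∀ i → coloursAt (connector i) (vy1 (next i)) ≡ # 0 ∷ []
  coloursAt-connector-y₁ i =
    trans (coloursAt-snd {u = vx i 2} {w = vy1 (next i)} (# 0) (((vx i 5 , vy3 (next i)) , # 1) ∷ []))
          (cong (# 0 ∷_) (coloursAt-away {w = vy1 (next i)} {u = vx i 5} {v = vy3 (next i)} (# 1) []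
                            (offsets≢ (next i) i 8 5 λ ()) (offsets≢ (next i) (next i) 8 10 λ ())))

  coloursAt-connector-y₃ : ∀ i → coloursAt (connector i) (vy3 (next i)) ≡ # 1 ∷ []
  coloursAt-connector-y₃ i =
    trans (coloursAt-away {w = vy3 (next i)} {u = vx i 2} {v = vy1 (next i)} (# 0) (((vx i 5 , vy3 (next i)) , # 1) ∷ [])
             (offsets≢ (next i) i 10 2 λ ()) (offsets≢ (next i) (next i) 10 8 λ ()))
          (coloursAt-snd {u = vx i 5} {w = vy3 (next i)} (# 1) [])

  connectors-single : ∀ {w} i → i < n → (∀ {i′} → i′ < n → i′ ≢ i → coloursAt (connector i′) w ≡ []) →
                      coloursAt connectors w ≡ coloursAt (connector i) w
  connectors-single {w} i i<n other =
    trans (coloursAt-concatMap connector (upTo n) w) (concatMap-upTo-single _ n i<n other)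

  next<n : ∀ i → next i < n
  next<n i = m%n<n (suc i) n

  coloursAt-connectors : ∀ {l j} → l < n → j < 11 → coloursAt connectors (vx l j) ≡ connectorColours j
  coloursAt-connectors {l} {j} l<n j<11 with j ≟ⁿ 2 | j ≟ⁿ 5 | j ≟ⁿ 8 | j ≟ⁿ 10
  ... | yes refl | _ | _ | _ =
    trans (connectors-single {vx l 2} l l<n λ {i} _ i≢l →
             copyVertex-connector-away i l j<11 (inj₁ (≢-sym i≢l)) (inj₂ λ ()) (inj₂ λ ()) (inj₂ λ ()))
          (coloursAt-connector-x₃ l)
  ... | no _ | yes refl | _ | _ =
    trans (connectors-single {vx l 5} l l<n λ {i} _ i≢l →
             copyVertex-connector-away i l j<11 (inj₂ λ ()) (inj₂ λ ()) (inj₁ (≢-sym i≢l)) (inj₂ λ ()))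
          (coloursAt-connector-x₆ l)
  ... | no _ | no _ | yes refl | _ with suc%-preimage (nLeaves a + nLeaves b) l<n
  ...   | i , i<n , refl , unique =
    trans (connectors-single {vy1 (next i)} i i<n λ {i′} i′<n i′≢i →
             copyVertex-connector-away i′ (next i) j<11 (inj₂ λ ()) (inj₁ (i′≢i ∘ unique i′<n ∘ sym)) (inj₂ λ ()) (inj₂ λ ()))
          (coloursAt-connector-y₁ i)
  coloursAt-connectors {l} {j} l<n j<11 | no _ | no _ | no _ | yes refl with suc%-preimage (nLeaves a + nLeaves b) l<n
  ...   | i , i<n , refl , unique =
    trans (connectors-single {vy3 (next i)} i i<n λ {i′} i′<n i′≢i →
             copyVertex-connector-away i′ (next i) j<11 (inj₂ λ ()) (inj₂ λ ()) (inj₂ λ ()) (inj₁ (i′≢i ∘ unique i′<n ∘ sym)))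
          (coloursAt-connector-y₃ i)
  coloursAt-connectors {l} {j} l<n j<11 | no j≢2 | no j≢5 | no j≢8 | no j≢10 =
    trans (coloursAt-concatMap connector (upTo n) (vx l j)) (concatMap-upTo-[] _ n λ {i} _ →
      copyVertex-connector-away i l j<11 (inj₂ j≢2) (inj₂ j≢8) (inj₂ j≢5) (inj₂ j≢10))

  coloursAt-snark : ∀ w → coloursAt snarkColouring w ≡ coloursAt treePart w ++ coloursAt copies w ++ coloursAt connectors w
  coloursAt-snark w =
    trans (coloursAt-++ treePart (copies ++ connectors) w) (cong (coloursAt treePart w ++_) (coloursAt-++ copies connectors w))

  coloursAt-copyVertex : ∀ {l j} → l < n → j < 11 → coloursAt snarkColouring (vx l j) ≡ copyColours (copyColour l) j
  coloursAt-copyVertex {l} {j} l<n j<11 =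
    trans (coloursAt-snark (vx l j))
          (cong₂ _++_ (coloursAt-treePart-copy l<n j<11) (cong₂ _++_ (coloursAt-copies l<n j<11) (coloursAt-connectors l<n j<11)))

  coloursAt-copies-inner : ∀ k → coloursAt copies (base + k) ≡ []
  coloursAt-copies-inner k = trans (coloursAt-concatMap copy (upTo n) (base + k)) (concatMap-upTo-[] _ n λ {i} i<n →
    coloursAt-translate-outside (11 * i) 11 (p0Colouring (copyColour i)) (base + k) (p0Colouring-bounded (copyColour i))
      (inner≢vx k i<n))

  coloursAt-connectors-inner : ∀ k → coloursAt connectors (base + k) ≡ []
  coloursAt-connectors-inner k = trans (coloursAt-concatMap connector (upTo n) (base + k)) (concatMap-upTo-[] _ n λ {i} i<n →
    connector-away i (inner≢vx k i<n (offset<11 2)) (inner≢vx k (next<n i) (offset<11 8))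
                     (inner≢vx k i<n (offset<11 5)) (inner≢vx k (next<n i) (offset<11 10)))

  coloursAt-snark-inner : ∀ k → coloursAt snarkColouring (base + k) ≡ coloursAt treePart (base + k)
  coloursAt-snark-inner k = begin
    coloursAt snarkColouring (base + k)                                   ≡⟨ coloursAt-snark (base + k) ⟩
    tree ++ coloursAt copies (base + k) ++ coloursAt connectors (base + k) ≡⟨ cong (λ xs → tree ++ xs ++ coloursAt connectors (base + k))
                                                                                    (coloursAt-copies-inner k) ⟩
    tree ++ coloursAt connectors (base + k)                               ≡⟨ cong (tree ++_) (coloursAt-connectors-inner k) ⟩
    tree ++ []                                                            ≡⟨ ++-identityʳ tree ⟩
    tree                                                                  ∎
    where
    open ≡-Reasoning
    tree = coloursAt treePart (base + k)

  coloursAt-innerVertex : ∀ {k} → k < nInner (nd a b) → ∃[ χ ] coloursAt snarkColouring (base + k) ≡ innerColours χ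
  coloursAt-innerVertex {k} k< =
    map₂ (trans (coloursAt-snark-inner k))
         (coloursAt-tree-inner (nd a b) (vy2 0) 1 0 zero separated (inner k (z≤n , k<) refl) (inner≢vx k z<s (offset<11 9)))

  TreeEnd : ℕ → Set
  TreeEnd w = ∃[ s ] coloursAt snarkColouring w ≡ treeEndColours s

  treeEnds-normalAt : ∀ {u v} → TreeEnd u → TreeEnd v → NormalAt snarkColouring (u , v)
  treeEnds-normalAt (s , colours-u) (t , colours-v) =
    subst₂ LocallyNormal (sym colours-u) (sym colours-v) (treeEdge-normal s t)

  treeEdge-normalAt : ∀ e → TreeEdge (vy2 0) 1 0 (nd a b) e → NormalAt snarkColouring e
  treeEdge-normalAt (u , v) (end₁ , end₂) =
    treeEnds-normalAt (Sum.[ root , innerEnd ]′ end₁) (Sum.[ innerEnd , leafEnd ]′ end₂)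
    where
    root : u ≡ vy2 0 → TreeEnd u
    root refl = inj₂ zero , coloursAt-copyVertex z<s (offset<11 9)
    innerEnd : ∀ {w} → Inner 0 (nd a b) w → TreeEnd w
    innerEnd (inner k (_ , k<) refl) = let χ , colours = coloursAt-innerVertex k< in inj₁ χ , colours
    leafEnd : ∀ {w} → Leaf 1 (nd a b) w → TreeEnd w
    leafEnd (leaf l (_ , l<n) refl) = inj₂ (copyColour l) , coloursAt-copyVertex l<n (offset<11 9)

  copyEdge-normalAt : ∀ i e → i < n → CopyEdgeNormal (copyColour i) e →
                      NormalAt snarkColouring (11 * i + proj₁ e , 11 * i + proj₂ e)
  copyEdge-normalAt i (x , y) i<n (x<11 , y<11 , normal) =
    subst₂ LocallyNormal (sym (coloursAt-copyVertex i<n x<11)) (sym (coloursAt-copyVertex i<n y<11)) normal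

  connector-normalAt : ∀ {i} → i < n → All (NormalAt snarkColouring ∘ proj₁) (connector i)
  connector-normalAt {i} i<n =
      subst₂ LocallyNormal (sym (coloursAt-copyVertex i<n (offset<11 2))) (sym (coloursAt-copyVertex (next<n i) (offset<11 8))) x₃y₁
    ∷ subst₂ LocallyNormal (sym (coloursAt-copyVertex i<n (offset<11 5))) (sym (coloursAt-copyVertex (next<n i) (offset<11 10))) x₆y₃
    ∷ []
    where x₃y₁ = proj₁ (connector-normal (copyColour i) (copyColour (next i)))
          x₆y₃ = proj₂ (connector-normal (copyColour i) (copyColour (next i)))

  snarkColouring-normal : All (NormalAt snarkColouring ∘ proj₁) snarkColouring
  snarkColouring-normal = Allₚ.++⁺
    (All.map (λ {x} → treeEdge-normalAt (proj₁ x)) (treeColouring-edges (nd a b) (vy2 0) 1 0 zero))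
    (Allₚ.++⁺
      (all-concatMap-upTo copy n λ {i} i<n →
        Allₚ.map⁺ (All.map (λ {x} → copyEdge-normalAt i (proj₁ x) i<n) (copyEdges-normal (copyColour i))))
      (all-concatMap-upTo connector n connector-normalAt))

theorem6 : (a b : BTree) → χN≤ (treelikeSnark a b) 6
theorem6 a b = subst (λ G → χN≤ G 6) edgesOf-snarkColouring
  (6 , ≤-refl , colouring snarkColouring , normalColouring snarkColouring (Allₚ.map⁺ snarkColouring-normal))
  where open Snark a b
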